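{- Let $G$ be a graph and let $G'$ be a graph with at least two nodes obtained from $G$ by a sequence of edge contractions and edge deletions. Then $k^*(G')\leqslant k^*(G)$.
   Context: Graphs are finite, undirected, may have loops and parallel edges, and have at least two nodes. For $G=(V,E)$ and $S\subseteq V$, $\delta(S)$ is the set of edges with exactly one endnode in $S$. The cut dominant is $\mathrm{CUT}(G)=\mathrm{conv}\{\chi^{\delta(S)} : \varnothing\neq S\subsetneq V\}+\mathbb{R}^E_+$, where $\chi^{F}\in\{0,1\}^E$ is the characteristic vector of $F\subseteq E$. Each facet-defining inequality $\langle c,x\rangle\geqslant\lambda$ of $\mathrm{CUT}(G)$ has a unique minimum integer form in which all coefficients of $c$ and $\lambda$ are relatively prime integers. $G$ is a $k$-graph if every facet-defining inequality of $\mathrm{CUT}(G)$ in minimum integer form has right-hand side $\lambda\leqslant k$; $k^*(G)$ is the least nonnegative integer $k$ such that $G$ is a $k$-graph.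
   Formalization: The cut dominant CUT(G) is represented by its points with rational coordinates, so validity and affine independence for facet-defining inequalities are taken over ℚ^E rather than ℝ^E. -}

module Defs where

open import Data.Nat as ℕ using (ℕ; zero; suc)
open import Data.Nat.Divisibility using (_∣_)
open import Data.Integer as ℤ using (ℤ; ∣_∣)
open import Data.Rational as ℚ using (ℚ; 0ℚ; 1ℚ; _+_; _*_; _-_; _≤_)
open import Data.Fin using (Fin; zero; suc)
open import Data.Bool using (Bool; true; false; _xor_)
open import Data.Product using (Σ; ∃; _×_; _,_; proj₁; proj₂)
open import Data.Sum using (_⊎_)
open import Relation.Nullary using (¬_)
open import Relation.Binary.PropositionalEquality using (_≡_)
open import Relation.Binary.Construct.Closure.ReflexiveTransitive using (Star)
open import Function.Bundles using (_⇔_)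

-- Finite (multi)graphs, possibly with loops and parallel edges.
-- Nodes are Fin n, edges are Fin m, and each edge has an (unordered)
-- pair of endnodes, stored as an ordered pair (orientation irrelevant).

record Graph : Set where
  field
    n    : ℕ
    m    : ℕ
    ends : Fin m → Fin n × Fin n
open Graph public

Node : Graph → Set
Node G = Fin (n G)

Edge : Graph → Set
Edge G = Fin (m G)

Σℚ : ∀ {k} → (Fin k → ℚ) → ℚ
Σℚ {zero}  f = 0ℚ
Σℚ {suc k} f = f zero + Σℚ (λ i → f (suc i))

NodeSet : Graph → Set
NodeSet G = Node G → Bool

ProperNonempty : (G : Graph) → NodeSet G → Set
ProperNonempty G S = (∃ λ v → S v ≡ true) × (∃ λ v → S v ≡ false)

bool→ℚ : Bool → ℚ
bool→ℚ true  = 1ℚ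
bool→ℚ false = 0ℚ

χδ : (G : Graph) → NodeSet G → Edge G → ℚ
χδ G S e = bool→ℚ (S (proj₁ (ends G e)) xor S (proj₂ (ends G e)))

-- The cut dominant CUT(G) = conv{χ^δ(S)} + ℝ^E_+  (rational points)

Vec : Graph → Set
Vec G = Edge G → ℚ

InCUT : (G : Graph) → Vec G → Set
InCUT G x =
  Σ ℕ λ r → Σ (Fin r → ℚ) λ w → Σ (Fin r → NodeSet G) λ S →
    ((j : Fin r) → ProperNonempty G (S j)) ×
    ((j : Fin r) → 0ℚ ≤ w j) ×
    (Σℚ w ≡ 1ℚ) ×
    ((e : Edge G) → Σℚ (λ j → w j * χδ G (S j) e) ≤ x e)

ℤ→ℚ : ℤ → ℚ
ℤ→ℚ z = z ℚ./ 1

⟨_,_⟩ : ∀ {G : Graph} → (Edge G → ℤ) → Vec G → ℚ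
⟨_,_⟩ {G} c x = Σℚ (λ e → ℤ→ℚ (c e) * x e)

InFace : (G : Graph) → (Edge G → ℤ) → ℤ → Vec G → Set
InFace G c λ₀ x = InCUT G x × (⟨_,_⟩ {G} c x ≡ ℤ→ℚ λ₀)

Valid : (G : Graph) → (Edge G → ℤ) → ℤ → Set
Valid G c λ₀ = (x : Vec G) → InCUT G x → ℤ→ℚ λ₀ ≤ ⟨_,_⟩ {G} c x

AffIndep : (G : Graph) → (k : ℕ) → (Fin (suc k) → Vec G) → Set
AffIndep G k p =
  (a : Fin k → ℚ) →
  ((e : Edge G) → Σℚ (λ i → a i * (p (suc i) e - p zero e)) ≡ 0ℚ) →
  (i : Fin k) → a i ≡ 0ℚ

HasAffIndep : (G : Graph) → (Vec G → Set) → ℕ → Set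
HasAffIndep G P k =
  Σ (Fin (suc k) → Vec G) λ p → ((i : Fin (suc k)) → P (p i)) × AffIndep G k p

-- dim P = d   (the largest d such that P contains d+1 affinely
-- independent points; only used for nonempty P)
HasDim : (G : Graph) → (Vec G → Set) → ℕ → Set
HasDim G P d = HasAffIndep G P d × ¬ HasAffIndep G P (suc d)

FacetDefining : (G : Graph) → (Edge G → ℤ) → ℤ → Set
FacetDefining G c λ₀ =
  Valid G c λ₀ ×
  Σ ℕ λ d → HasDim G (InFace G c λ₀) d × HasDim G (InCUT G) (suc d)

MinIntegerForm : (G : Graph) → (Edge G → ℤ) → ℤ → Set
MinIntegerForm G c λ₀ =
  (d : ℕ) → ((e : Edge G) → d ∣ ∣ c e ∣) → d ∣ ∣ λ₀ ∣ → d ≡ 1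

IsKGraph : Graph → ℕ → Set
IsKGraph G k =
  (c : Edge G → ℤ) (λ₀ : ℤ) → FacetDefining G c λ₀ → MinIntegerForm G c λ₀ →
  λ₀ ℤ.≤ ℤ.+ k

IsKStar : Graph → ℕ → Set
IsKStar G k = IsKGraph G k × ((j : ℕ) → IsKGraph G j → k ℕ.≤ j)

-- G' arises from G by removing edge e and identifying nodes according to
-- φ : V(G) → V(G') (surjective), with edges of G' in bijection (ψ) with
-- E(G) ∖ {e}, endnodes respected.
EdgeMap : (G G' : Graph) → Edge G → (Node G → Node G') → Set
EdgeMap G G' e φ =
  Σ (Edge G' → Edge G) λ ψ →
    ((f g : Edge G') → ψ f ≡ ψ g → f ≡ g) ×
    ((f : Edge G') → ¬ (ψ f ≡ e)) ×
    ((g : Edge G) → ¬ (g ≡ e) → ∃ λ f → ψ f ≡ g) ×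
    ((f : Edge G') →
       let a = proj₁ (ends G (ψ f)) ; b = proj₂ (ends G (ψ f))
           a' = proj₁ (ends G' f) ; b' = proj₂ (ends G' f) in
       (φ a ≡ a' × φ b ≡ b') ⊎ (φ a ≡ b' × φ b ≡ a'))

Deletion : Graph → Graph → Set
Deletion G G' =
  Σ (Edge G) λ e → Σ (Node G → Node G') λ φ →
    ((a b : Node G) → φ a ≡ φ b → a ≡ b) ×
    ((a' : Node G') → ∃ λ a → φ a ≡ a') ×
    EdgeMap G G' e φ

-- G' = G / e  : the two endnodes u,v of e are identified (a loop
-- contraction is thus the same as its deletion)
Contraction : Graph → Graph → Set
Contraction G G' =
  Σ (Edge G) λ e → Σ (Node G → Node G') λ φ →
    let u = proj₁ (ends G e) ; v = proj₂ (ends G e) in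
    ((a b : Node G) → (φ a ≡ φ b) ⇔ (a ≡ b ⊎ (a ≡ u × b ≡ v) ⊎ (a ≡ v × b ≡ u))) ×
    ((a' : Node G') → ∃ λ a → φ a ≡ a') ×
    EdgeMap G G' e φ

Step : Graph → Graph → Set
Step G G' = Deletion G G' ⊎ Contraction G G'

ObtainedBy : Graph → Graph → Set
ObtainedBy = Star Step

module Submission where

-- It suffices that deleting or contracting one edge e of a k-graph G
-- gives a k-graph G'.  Let ⟨c,x⟩ ≥ λ be facet-defining for CUT(G') and in
-- minimum integer form.  Choosing an integer coefficient M for e extends it
-- to M·x_e + ⟨c,x⟩ ≥ λ, which is still in minimum integer form with the
-- same right-hand side; once it is facet-defining for CUT(G), λ ≤ k follows
-- because G is a k-graph.  For a deletion M = 0; for a contraction M is the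
-- largest amount by which a cut through e falls short of λ on the other
-- edges.  Facetness comes from a lifting lemma: extending points of CUT(G')
-- by a fixed value t on e, and adding one point with x_e = t + 1, raises the
-- affine dimension of both the face and CUT by one, while linear dependence
-- in ℚ^E caps both.

open import Defs
open import Data.Nat as ℕ using (ℕ; zero; suc; _≤_; _<_)
import Data.Nat.Properties as ℕP
open import Data.Nat.Divisibility using (_∣_)
open import Data.Fin as Fin using (Fin; zero; suc; punchIn)
import Data.Fin.Properties as FinP
open import Data.Integer as ℤ using (ℤ)
import Data.Integer.Properties as ℤP
open import Data.Rational as ℚ using (ℚ; 0ℚ; 1ℚ; _+_; _*_; _-_; -_; 1/_)
open import Data.Rational.Properties
open import Data.Rational.Solver using (module +-*-Solver)
open import Data.Fin.Permutation using (Permutation; permutation; ↔⇒≡)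
open import Data.Vec.Functional using (insertAt; _∷_)
open import Data.Vec.Functional.Properties using (insertAt-lookup; insertAt-punchIn)
open import Data.Product using (Σ; ∃; _×_; _,_; proj₁; proj₂; uncurry)
open import Data.Sum using (_⊎_; inj₁; inj₂)
open import Data.Empty using (⊥-elim)
open import Relation.Nullary using (¬_; yes; no; does; ¬?)
open import Relation.Binary.PropositionalEquality
open import Algebra.Bundles using (CommutativeRing; CommutativeMonoid)
import Algebra.Properties.Semiring.Sum as SemiringSum
import Algebra.Properties.CommutativeSemigroup as CommutativeSemigroupProperties
open import Data.Rational.Literals using (fromℤ)
open import Data.Bool using (Bool; true; false; if_then_else_; _xor_)
open import Data.Bool.Properties using (xor-comm; xor-same)
open import Function.Bundles using (_⇔_; Equivalence)
open import Relation.Binary.Construct.Closure.ReflexiveTransitive using (ε; _◅_)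

open +-*-Solver

-- Finite sums.  Σℚ (from Defs) agrees with the library's semiring sum,
-- through which its algebraic laws are obtained.

private
  module ∑ = SemiringSum (CommutativeRing.semiring +-*-commutativeRing)
  module ∑ℤ = SemiringSum (CommutativeRing.semiring ℤP.+-*-commutativeRing)

open CommutativeSemigroupProperties (CommutativeMonoid.commutativeSemigroup *-1-commutativeMonoid)
  using () renaming (x∙yz≈y∙xz to *-comm-middle)

Σℚ≡sum : ∀ {k} (f : Fin k → ℚ) → Σℚ f ≡ ∑.sum f
Σℚ≡sum {zero}  f = refl
Σℚ≡sum {suc k} f = cong (f zero +_) (Σℚ≡sum (λ i → f (suc i)))

Σℚ-cong : ∀ {k} {f g : Fin k → ℚ} → (∀ i → f i ≡ g i) → Σℚ f ≡ Σℚ g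
Σℚ-cong {f = f} {g} f≗g =
  trans (Σℚ≡sum f) (trans (∑.sum-cong-≗ f≗g) (sym (Σℚ≡sum g)))

Σℚ-zero : ∀ {k} (f : Fin k → ℚ) → (∀ i → f i ≡ 0ℚ) → Σℚ f ≡ 0ℚ
Σℚ-zero {k} f f≗0 =
  trans (Σℚ≡sum f) (trans (∑.sum-cong-≗ f≗0) (∑.sum-replicate-zero k))

Σℚ-+ : ∀ {k} (f g : Fin k → ℚ) → Σℚ (λ i → f i + g i) ≡ Σℚ f + Σℚ g
Σℚ-+ f g = trans (Σℚ≡sum (λ i → f i + g i))
  (trans (∑.∑-distrib-+ f g) (sym (cong₂ _+_ (Σℚ≡sum f) (Σℚ≡sum g))))

Σℚ-*ˡ : ∀ {k} (a : ℚ) (f : Fin k → ℚ) → Σℚ (λ i → a * f i) ≡ a * Σℚ f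
Σℚ-*ˡ a f = trans (Σℚ≡sum (λ i → a * f i))
  (trans (sym (∑.*-distribˡ-sum a f)) (cong (a *_) (sym (Σℚ≡sum f))))

Σℚ-*ʳ : ∀ {k} (a : ℚ) (f : Fin k → ℚ) → Σℚ (λ i → f i * a) ≡ Σℚ f * a
Σℚ-*ʳ a f = trans (Σℚ-cong (λ i → *-comm (f i) a)) (trans (Σℚ-*ˡ a f) (*-comm a _))

Σℚ-- : ∀ {k} (f g : Fin k → ℚ) → Σℚ (λ i → f i - g i) ≡ Σℚ f - Σℚ g
Σℚ-- f g = begin
  Σℚ (λ i → f i - g i)            ≡⟨ Σℚ-cong (λ i → cong (f i +_) (neg≡-1* (g i))) ⟩
  Σℚ (λ i → f i + (- 1ℚ) * g i)   ≡⟨ Σℚ-+ f (λ i → (- 1ℚ) * g i) ⟩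
  Σℚ f + Σℚ (λ i → (- 1ℚ) * g i)  ≡⟨ cong (Σℚ f +_) (Σℚ-*ˡ (- 1ℚ) g) ⟩
  Σℚ f + (- 1ℚ) * Σℚ g            ≡⟨ cong (Σℚ f +_) (sym (neg≡-1* (Σℚ g))) ⟩
  Σℚ f - Σℚ g                     ∎
  where
    open ≡-Reasoning
    neg≡-1* : ∀ x → - x ≡ (- 1ℚ) * x
    neg≡-1* = solve 1 (λ x → :- x := (:- con 1ℚ) :* x) refl

Σℚ-remove : ∀ {k} (p : Fin (suc k)) (f : Fin (suc k) → ℚ) →
            Σℚ f ≡ f p + Σℚ (λ i → f (punchIn p i))
Σℚ-remove p f = trans (Σℚ≡sum f)
  (trans (∑.sum-remove {i = p} f) (cong (f p +_) (sym (Σℚ≡sum (λ i → f (punchIn p i))))))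

Σℚ-swap : ∀ {k l} (H : Fin k → Fin l → ℚ) →
          Σℚ (λ i → Σℚ (H i)) ≡ Σℚ (λ j → Σℚ (λ i → H i j))
Σℚ-swap H = begin
  Σℚ (λ i → Σℚ (H i))                ≡⟨ Σℚ-cong (λ i → Σℚ≡sum (H i)) ⟩
  Σℚ (λ i → ∑.sum (H i))             ≡⟨ Σℚ≡sum (λ i → ∑.sum (H i)) ⟩
  ∑.sum (λ i → ∑.sum (H i))          ≡⟨ ∑.∑-comm H ⟩
  ∑.sum (λ j → ∑.sum (λ i → H i j))  ≡⟨ sym (Σℚ≡sum (λ j → ∑.sum (λ i → H i j))) ⟩
  Σℚ (λ j → ∑.sum (λ i → H i j))     ≡⟨ sym (Σℚ-cong (λ j → Σℚ≡sum (λ i → H i j))) ⟩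
  Σℚ (λ j → Σℚ (λ i → H i j))        ∎
  where open ≡-Reasoning

Σℚ-mono : ∀ {k} {f g : Fin k → ℚ} → (∀ i → f i ℚ.≤ g i) → Σℚ f ℚ.≤ Σℚ g
Σℚ-mono {zero}  f≤g = ≤-refl
Σℚ-mono {suc k} f≤g = +-mono-≤ (f≤g zero) (Σℚ-mono (λ i → f≤g (suc i)))

0≤1 : 0ℚ ℚ.≤ 1ℚ
0≤1 = ℚ.*≤* (ℤ.+≤+ ℕ.z≤n)

p≤p+q : ∀ {p q} → 0ℚ ℚ.≤ q → p ℚ.≤ p + q
p≤p+q {p} {q} q≥0 = subst (ℚ._≤ p + q) (+-identityʳ p) (+-monoʳ-≤ p q≥0)

scale-≤ : ∀ {r p q : ℚ} → 0ℚ ℚ.≤ r → p ℚ.≤ q → r * p ℚ.≤ r * q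
scale-≤ {r} r≥0 = *-monoˡ-≤-nonNeg r {{ℚ.nonNegative r≥0}}

convex-bound : ∀ {k} (w y : Fin k → ℚ) (t : ℚ) → (∀ j → 0ℚ ℚ.≤ w j) → Σℚ w ≡ 1ℚ →
               (∀ j → y j ℚ.≤ t) → Σℚ (λ j → w j * y j) ℚ.≤ t
convex-bound w y t w≥0 Σw≡1 y≤t = begin
  Σℚ (λ j → w j * y j)  ≤⟨ Σℚ-mono (λ j → scale-≤ (w≥0 j) (y≤t j)) ⟩
  Σℚ (λ j → w j * t)    ≡⟨ Σℚ-*ʳ t w ⟩
  Σℚ w * t              ≡⟨ cong (_* t) Σw≡1 ⟩
  1ℚ * t                ≡⟨ *-identityˡ t ⟩
  t                     ∎
  where open ≤-Reasoning

δ : ∀ {k} → Fin k → Fin k → ℚ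
δ i j = if does (i Fin.≟ j) then 1ℚ else 0ℚ

δ-diag : ∀ {k} (i : Fin k) → δ i i ≡ 1ℚ
δ-diag i with i Fin.≟ i
... | yes _  = refl
... | no i≢i = ⊥-elim (i≢i refl)

δ-off : ∀ {k} {i j : Fin k} → i ≢ j → δ i j ≡ 0ℚ
δ-off {i = i} {j} i≢j with i Fin.≟ j
... | yes i≡j = ⊥-elim (i≢j i≡j)
... | no _    = refl

δ-nonneg : ∀ {k} (i j : Fin k) → 0ℚ ℚ.≤ δ i j
δ-nonneg i j with i Fin.≟ j
... | yes _ = 0≤1
... | no _  = ≤-refl

Σℚ-δ : ∀ {k} (a : Fin k → ℚ) (i₀ : Fin k) → Σℚ (λ i → a i * δ i i₀) ≡ a i₀
Σℚ-δ {suc k} a i₀ = begin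
  Σℚ (λ i → a i * δ i i₀)                  ≡⟨ Σℚ-remove i₀ (λ i → a i * δ i i₀) ⟩
  a i₀ * δ i₀ i₀ + Σℚ (λ i → off i)        ≡⟨ cong₂ _+_ (trans (cong (a i₀ *_) (δ-diag i₀)) (*-identityʳ (a i₀)))
                                                        (Σℚ-zero off off≡0) ⟩
  a i₀ + 0ℚ                                ≡⟨ +-identityʳ (a i₀) ⟩
  a i₀                                     ∎
  where
    open ≡-Reasoning
    off : Fin k → ℚ
    off i = a (punchIn i₀ i) * δ (punchIn i₀ i) i₀
    off≡0 : ∀ i → off i ≡ 0ℚ
    off≡0 i = trans (cong (a (punchIn i₀ i) *_) (δ-off (FinP.punchInᵢ≢i i₀ i))) (*-zeroʳ (a (punchIn i₀ i)))

Dependent : ∀ k m → (Fin k → Fin m → ℚ) → Set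
Dependent k m v =
  Σ (Fin k → ℚ) λ a → (∃ λ i → a i ≢ 0ℚ) × (∀ j → Σℚ (λ i → a i * v i j) ≡ 0ℚ)

*-≢0 : ∀ {x y : ℚ} → x ≢ 0ℚ → y ≢ 0ℚ → x * y ≢ 0ℚ
*-≢0 {x} {y} x≢0 y≢0 xy≡0 = x≢0 (begin
    x                 ≡⟨ sym (*-identityʳ x) ⟩
    x * 1ℚ            ≡⟨ cong (x *_) (sym (*-inverseʳ y)) ⟩
    x * (y * (1/ y))  ≡⟨ sym (*-assoc x y _) ⟩
    (x * y) * (1/ y)  ≡⟨ cong (_* (1/ y)) xy≡0 ⟩
    0ℚ * (1/ y)       ≡⟨ *-zeroˡ (1/ y) ⟩
    0ℚ                ∎)
  where
    open ≡-Reasoning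
    instance _ = ℚ.≢-nonZero y≢0

*-cancelˡ-≡0 : ∀ {x y : ℚ} → x ≢ 0ℚ → x * y ≡ 0ℚ → y ≡ 0ℚ
*-cancelˡ-≡0 {x} {y} x≢0 xy≡0 with y ≟ 0ℚ
... | yes y≡0 = y≡0
... | no  y≢0 = ⊥-elim (*-≢0 x≢0 y≢0 xy≡0)

all-zero : ∀ {k} (f : Fin k → ℚ) → ¬ (∃ λ i → f i ≢ 0ℚ) → ∀ i → f i ≡ 0ℚ
all-zero f no-nonzero i with f i ≟ 0ℚ
... | yes fi≡0 = fi≡0
... | no  fi≢0 = ⊥-elim (no-nonzero (i , fi≢0))

dependent-without-zero-coordinate : ∀ {k m} (v : Fin k → Fin (suc m) → ℚ) →
  (∀ i → v i zero ≡ 0ℚ) → Dependent k m (λ i j → v i (suc j)) → Dependent k (suc m) v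
dependent-without-zero-coordinate v v₀≡0 (a , nontrivial , vanish) = a , nontrivial , vanish′
  where
    vanish′ : ∀ j → Σℚ (λ i → a i * v i j) ≡ 0ℚ
    vanish′ zero    = Σℚ-zero (λ i → a i * v i zero) (λ i → trans (cong (a i *_) (v₀≡0 i)) (*-zeroʳ (a i)))
    vanish′ (suc j) = vanish j

-- one elimination step: use vector p (with pivot v p zero) to clear the
-- first coordinate of all other vectors
eliminate : ∀ {k m} → (Fin (suc k) → Fin (suc m) → ℚ) → Fin (suc k) → Fin k → Fin m → ℚ
eliminate v p i j = v p zero * v (punchIn p i) (suc j) - v (punchIn p i) zero * v p (suc j)

-- A dependence b among the eliminated vectors yields the dependence
-- a = b·pivot on the other vectors and a_p = -Σ b_i v_i(0) on the pivot.
dependent-after-elimination : ∀ {k m} (v : Fin (suc k) → Fin (suc m) → ℚ) (p : Fin (suc k)) →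
  v p zero ≢ 0ℚ → Dependent k m (eliminate v p) → Dependent (suc k) (suc m) v
dependent-after-elimination {k} {m} v p piv≢0 (b , (i₀ , bi₀≢0) , vanish) = a , nontrivial , vanish′
  where
    piv : ℚ
    piv = v p zero
    v′ : Fin k → Fin (suc m) → ℚ
    v′ i = v (punchIn p i)
    a : Fin (suc k) → ℚ
    a = insertAt (λ i → b i * piv) p (- Σℚ (λ i → b i * v′ i zero))

    nontrivial : ∃ λ i → a i ≢ 0ℚ
    nontrivial = punchIn p i₀ , λ eq → *-≢0 bi₀≢0 piv≢0 (trans (sym (insertAt-punchIn _ p _ i₀)) eq)

    combination : ∀ j → Σℚ (λ i → a i * v i j) ≡ Σℚ (λ i → b i * (piv * v′ i j - v′ i zero * v p j))
    combination j = begin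
      Σℚ (λ i → a i * v i j)
        ≡⟨ Σℚ-remove p (λ i → a i * v i j) ⟩
      a p * v p j + Σℚ (λ i → a (punchIn p i) * v′ i j)
        ≡⟨ cong₂ _+_ (cong (_* v p j) (insertAt-lookup _ p _))
                     (Σℚ-cong (λ i → cong (_* v′ i j) (insertAt-punchIn _ p _ i))) ⟩
      - Σℚ (λ i → b i * v′ i zero) * v p j + Σℚ (λ i → b i * piv * v′ i j)
        ≡⟨ cong (_+ Σℚ (λ i → b i * piv * v′ i j))
             (trans (sym (neg-distribˡ-* (Σℚ (λ i → b i * v′ i zero)) (v p j)))
                    (cong -_ (sym (Σℚ-*ʳ (v p j) (λ i → b i * v′ i zero))))) ⟩
      - Σℚ (λ i → b i * v′ i zero * v p j) + Σℚ (λ i → b i * piv * v′ i j)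
        ≡⟨ sym (trans (Σℚ-- (λ i → b i * piv * v′ i j) (λ i → b i * v′ i zero * v p j))
                      (+-comm (Σℚ (λ i → b i * piv * v′ i j)) _)) ⟩
      Σℚ (λ i → b i * piv * v′ i j - b i * v′ i zero * v p j)
        ≡⟨ Σℚ-cong (λ i → solve 5 (λ B P Y X Z → B :* P :* Y :- B :* X :* Z := B :* (P :* Y :- X :* Z))
                                  refl (b i) piv (v′ i j) (v′ i zero) (v p j)) ⟩
      Σℚ (λ i → b i * (piv * v′ i j - v′ i zero * v p j)) ∎
      where open ≡-Reasoning

    vanish′ : ∀ j → Σℚ (λ i → a i * v i j) ≡ 0ℚ
    vanish′ zero    = trans (combination zero)
      (Σℚ-zero _ (λ i → solve 3 (λ B P X → B :* (P :* X :- X :* P) := con 0ℚ) refl (b i) piv (v′ i zero)))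
    vanish′ (suc j) = trans (combination (suc j)) (vanish j)

-- More than m vectors in ℚ^m are linearly dependent, by induction on m:
-- for m = 0 any single coefficient works; otherwise eliminate with a
-- vector whose first coordinate is nonzero, or drop the first coordinate
-- if there is none.
dependent-if-more-than-dimension : ∀ m k → m < k → (v : Fin k → Fin m → ℚ) → Dependent k m v
dependent-if-more-than-dimension zero (suc k) _ v =
  (λ i → δ i zero) , (zero , 1≢0) , λ ()
dependent-if-more-than-dimension (suc m) (suc k) (ℕ.s≤s m<k) v
  with FinP.any? (λ i → ¬? (v i zero ≟ 0ℚ))
... | yes (p , piv≢0) =
  dependent-after-elimination v p piv≢0
    (dependent-if-more-than-dimension m k m<k (eliminate v p))
... | no no-pivot =
  dependent-without-zero-coordinate v (all-zero (λ i → v i zero) no-pivot)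
    (dependent-if-more-than-dimension m (suc k) (ℕP.m≤n⇒m≤1+n m<k) (λ i j → v i (suc j)))

-- m vectors of ℚ^m orthogonal to some c with c_g ≠ 0 are dependent: a
-- dependence among their coordinates other than g also vanishes at g,
-- because c · Σ a_i v_i = Σ a_i (c · v_i) = 0.
dependent-in-hyperplane : ∀ m k → m ≤ k → (v : Fin k → Fin m → ℚ) (c : Fin m → ℚ) (g : Fin m) →
  c g ≢ 0ℚ → (∀ i → Σℚ (λ j → c j * v i j) ≡ 0ℚ) → Dependent k m v
dependent-in-hyperplane (suc m) k m<k v c g cg≢0 v⊥c
  with dependent-if-more-than-dimension m k m<k (λ i j → v i (punchIn g j))
... | a , nontrivial , vanish-off-g = a , nontrivial , vanish
  where
    z : Fin (suc m) → ℚ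
    z j = Σℚ (λ i → a i * v i j)

    c⊥z : Σℚ (λ j → c j * z j) ≡ 0ℚ
    c⊥z = begin
      Σℚ (λ j → c j * z j)                        ≡⟨ Σℚ-cong (λ j → sym (Σℚ-*ˡ (c j) (λ i → a i * v i j))) ⟩
      Σℚ (λ j → Σℚ (λ i → c j * (a i * v i j)))   ≡⟨ sym (Σℚ-swap (λ i j → c j * (a i * v i j))) ⟩
      Σℚ (λ i → Σℚ (λ j → c j * (a i * v i j)))   ≡⟨ Σℚ-cong (λ i → trans
                                                         (Σℚ-cong (λ j → *-comm-middle (c j) (a i) (v i j)))
                                                         (Σℚ-*ˡ (a i) (λ j → c j * v i j))) ⟩
      Σℚ (λ i → a i * Σℚ (λ j → c j * v i j))     ≡⟨ Σℚ-zero _ (λ i → trans (cong (a i *_) (v⊥c i)) (*-zeroʳ (a i))) ⟩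
      0ℚ                                          ∎
      where
        open ≡-Reasoning

    c·z≡cg·zg : Σℚ (λ j → c j * z j) ≡ c g * z g
    c·z≡cg·zg = trans (Σℚ-remove g (λ j → c j * z j))
      (trans (cong (c g * z g +_) (Σℚ-zero _ (λ j → trans (cong (c (punchIn g j) *_) (vanish-off-g j))
                                                          (*-zeroʳ (c (punchIn g j))))))
             (+-identityʳ _))

    vanish : ∀ j → z j ≡ 0ℚ
    vanish j with g Fin.≟ j
    ... | yes refl = *-cancelˡ-≡0 cg≢0 (trans (sym c·z≡cg·zg) c⊥z)
    ... | no g≢j   = trans (cong z (sym (FinP.punchIn-punchOut g≢j))) (vanish-off-g _)

ℤ→ℚ≡fromℤ : ∀ z → ℤ→ℚ z ≡ fromℤ z
ℤ→ℚ≡fromℤ z = ↥p/↧p≡p (fromℤ z)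

-- fromℤ a + fromℤ b computes to (a·1 + b·1)/1
fromℤ-+ : ∀ a b → fromℤ a + fromℤ b ≡ fromℤ (a ℤ.+ b)
fromℤ-+ a b = trans (cong (ℚ._/ 1) (cong₂ ℤ._+_ (ℤP.*-identityʳ a) (ℤP.*-identityʳ b)))
                    (ℤ→ℚ≡fromℤ (a ℤ.+ b))

ℤ→ℚ-+ : ∀ a b → ℤ→ℚ (a ℤ.+ b) ≡ ℤ→ℚ a + ℤ→ℚ b
ℤ→ℚ-+ a b = trans (ℤ→ℚ≡fromℤ (a ℤ.+ b))
  (trans (sym (fromℤ-+ a b)) (sym (cong₂ _+_ (ℤ→ℚ≡fromℤ a) (ℤ→ℚ≡fromℤ b))))

ℤ→ℚ-mono : ∀ {a b} → a ℤ.≤ b → ℤ→ℚ a ℚ.≤ ℤ→ℚ b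
ℤ→ℚ-mono {a} {b} a≤b rewrite ℤ→ℚ≡fromℤ a | ℤ→ℚ≡fromℤ b =
  ℚ.*≤* (subst₂ ℤ._≤_ (sym (ℤP.*-identityʳ a)) (sym (ℤP.*-identityʳ b)) a≤b)

ℤ→ℚ-sum : ∀ {k} (f : Fin k → ℤ) → ℤ→ℚ (∑ℤ.sum f) ≡ Σℚ (λ i → ℤ→ℚ (f i))
ℤ→ℚ-sum {zero}  f = refl
ℤ→ℚ-sum {suc k} f = trans (ℤ→ℚ-+ (f zero) (∑ℤ.sum (λ i → f (suc i))))
                          (cong (ℤ→ℚ (f zero) +_) (ℤ→ℚ-sum (λ i → f (suc i))))

[a-b]+b≡a : ∀ a b → (a ℤ.- b) ℤ.+ b ≡ a
[a-b]+b≡a a b = trans (ℤP.+-assoc a (ℤ.- b) b) (trans (cong (λ z → a ℤ.+ z) (ℤP.+-inverseˡ b)) (ℤP.+-identityʳ a))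

bool→ℤ : Bool → ℤ
bool→ℤ true  = ℤ.+ 1
bool→ℤ false = ℤ.+ 0

ℤ→ℚ-*-bool : ∀ c b → ℤ→ℚ (c ℤ.* bool→ℤ b) ≡ ℤ→ℚ c * bool→ℚ b
ℤ→ℚ-*-bool c true  = trans (cong ℤ→ℚ (ℤP.*-identityʳ c)) (sym (*-identityʳ (ℤ→ℚ c)))
ℤ→ℚ-*-bool c false = trans (cong ℤ→ℚ (ℤP.*-zeroʳ c)) (sym (*-zeroʳ (ℤ→ℚ c)))

-- an integer function of the subsets of an n-set attains its maximum
-- (subsets are indicator functions, so h must respect pointwise equality)
maximum-over-subsets : ∀ n (h : (Fin n → Bool) → ℤ) → (∀ S T → (∀ i → S i ≡ T i) → h S ≡ h T) →
                       Σ (Fin n → Bool) λ S₀ → ∀ S → h S ℤ.≤ h S₀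
maximum-over-subsets zero h respects = (λ ()) , λ S → ℤP.≤-reflexive (respects S (λ ()) (λ ()))
maximum-over-subsets (suc n) h respects =
  choose (maximum-over-subsets n (λ T → h (true ∷ T)) (λ S T S≗T → respects _ _ (∷-cong S≗T)))
         (maximum-over-subsets n (λ T → h (false ∷ T)) (λ S T S≗T → respects _ _ (∷-cong S≗T)))
  where
    ∷-cong : ∀ {b} {S T : Fin n → Bool} → (∀ i → S i ≡ T i) → ∀ i → (b ∷ S) i ≡ (b ∷ T) i
    ∷-cong S≗T zero    = refl
    ∷-cong S≗T (suc i) = S≗T i

    bounded : ∀ {T₁ T₀} → (∀ T → h (true ∷ T) ℤ.≤ h (true ∷ T₁)) → (∀ T → h (false ∷ T) ℤ.≤ h (false ∷ T₀)) →
              ∀ S₀ → h (true ∷ T₁) ℤ.≤ h S₀ → h (false ∷ T₀) ℤ.≤ h S₀ → ∀ S → h S ℤ.≤ h S₀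
    bounded max₁ max₀ S₀ ≤₁ ≤₀ S = ℤP.≤-trans (ℤP.≤-reflexive (respects S _ head-tail)) (by-head (S zero))
      where
        head-tail : ∀ i → S i ≡ (S zero ∷ (λ i → S (suc i))) i
        head-tail zero    = refl
        head-tail (suc i) = refl
        by-head : ∀ b → h (b ∷ (λ i → S (suc i))) ℤ.≤ h S₀
        by-head true  = ℤP.≤-trans (max₁ _) ≤₁
        by-head false = ℤP.≤-trans (max₀ _) ≤₀

    choose : (Σ (Fin n → Bool) λ T₁ → ∀ T → h (true ∷ T) ℤ.≤ h (true ∷ T₁)) →
             (Σ (Fin n → Bool) λ T₀ → ∀ T → h (false ∷ T) ℤ.≤ h (false ∷ T₀)) →
             Σ (Fin (suc n) → Bool) λ S₀ → ∀ S → h S ℤ.≤ h S₀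
    choose (T₁ , max₁) (T₀ , max₀) with ℤP.≤-total (h (true ∷ T₁)) (h (false ∷ T₀))
    ... | inj₁ ≤₀ = false ∷ T₀ , bounded max₁ max₀ (false ∷ T₀) ≤₀ ℤP.≤-refl
    ... | inj₂ ≤₁ = true ∷ T₁ , bounded max₁ max₀ (true ∷ T₁) ℤP.≤-refl ≤₁

module CutDominant (G : Graph) where

  _·_ : (Edge G → ℤ) → Vec G → ℚ
  c · x = ⟨_,_⟩ {G} c x

  raise : Vec G → Edge G → Vec G
  raise x f g = x g + δ g f

  differences : ∀ {k} → (Fin (suc k) → Vec G) → Fin k → Edge G → ℚ
  differences p i g = p (suc i) g - p zero g

  CUT-upward : ∀ {x y : Vec G} → InCUT G x → (∀ g → x g ℚ.≤ y g) → InCUT G y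
  CUT-upward (r , w , S , proper , w≥0 , Σw≡1 , below) x≤y =
    r , w , S , proper , w≥0 , Σw≡1 , λ g → ≤-trans (below g) (x≤y g)

  raise-upward : ∀ {x : Vec G} f → InCUT G x → InCUT G (raise x f)
  raise-upward {x} f x∈CUT = CUT-upward x∈CUT (λ g → p≤p+q (δ-nonneg g f))

  cut-in-CUT : ∀ S → ProperNonempty G S → InCUT G (χδ G S)
  cut-in-CUT S proper =
    1 , (λ _ → 1ℚ) , (λ _ → S) , (λ _ → proper) , (λ _ → 0≤1) , +-identityʳ 1ℚ ,
    λ g → ≤-reflexive (trans (+-identityʳ _) (*-identityˡ _))

  ·-differences : ∀ c (x y : Vec G) → Σℚ (λ g → ℤ→ℚ (c g) * (x g - y g)) ≡ c · x - c · y
  ·-differences c x y =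
    trans (Σℚ-cong (λ g → *-distribˡ-- (ℤ→ℚ (c g)) (x g) (y g)))
          (Σℚ-- (λ g → ℤ→ℚ (c g) * x g) (λ g → ℤ→ℚ (c g) * y g))
    where
      *-distribˡ-- : ∀ a u v → a * (u - v) ≡ a * u - a * v
      *-distribˡ-- = solve 3 (λ a u v → a :* (u :- v) := a :* u :- a :* v) refl

  ·-raise : ∀ c (x : Vec G) f → c · raise x f ≡ c · x + ℤ→ℚ (c f)
  ·-raise c x f = trans (Σℚ-cong (λ g → *-distribˡ-+ (ℤ→ℚ (c g)) (x g) (δ g f)))
    (trans (Σℚ-+ (λ g → ℤ→ℚ (c g) * x g) (λ g → ℤ→ℚ (c g) * δ g f))
           (cong (c · x +_) (Σℚ-δ (λ g → ℤ→ℚ (c g)) f)))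

  ·-average : ∀ c {r} (w : Fin r → ℚ) (y : Fin r → Vec G) →
              Σℚ (λ j → w j * c · y j) ≡ Σℚ (λ g → ℤ→ℚ (c g) * Σℚ (λ j → w j * y j g))
  ·-average c w y = begin
    Σℚ (λ j → w j * c · y j)                           ≡⟨ Σℚ-cong (λ j → sym (Σℚ-*ˡ (w j) (λ g → C g * y j g))) ⟩
    Σℚ (λ j → Σℚ (λ g → w j * (C g * y j g)))          ≡⟨ Σℚ-cong (λ j → Σℚ-cong (λ g → *-comm-middle (w j) (C g) (y j g))) ⟩
    Σℚ (λ j → Σℚ (λ g → C g * (w j * y j g)))          ≡⟨ Σℚ-swap (λ j g → C g * (w j * y j g)) ⟩
    Σℚ (λ g → Σℚ (λ j → C g * (w j * y j g)))          ≡⟨ Σℚ-cong (λ g → Σℚ-*ˡ (C g) (λ j → w j * y j g)) ⟩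
    Σℚ (λ g → C g * Σℚ (λ j → w j * y j g))            ∎
    where
      open ≡-Reasoning
      C : Edge G → ℚ
      C g = ℤ→ℚ (c g)

  -- An inequality with nonnegative coefficients is valid as soon as it
  -- holds at the cut vectors: average the cuts, then go upwards.
  valid-from-cuts : ∀ c λ₀ → (∀ g → 0ℚ ℚ.≤ ℤ→ℚ (c g)) →
    (∀ S → ProperNonempty G S → ℤ→ℚ λ₀ ℚ.≤ c · χδ G S) → Valid G c λ₀
  valid-from-cuts c λ₀ c≥0 cuts x (r , w , S , proper , w≥0 , Σw≡1 , below) = begin
    ℤ→ℚ λ₀                                          ≡⟨ sym average-of-λ ⟩
    Σℚ (λ j → w j * ℤ→ℚ λ₀)                         ≤⟨ Σℚ-mono (λ j → scale-≤ (w≥0 j) (cuts (S j) (proper j))) ⟩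
    Σℚ (λ j → w j * c · χ j)                        ≡⟨ ·-average c w χ ⟩
    Σℚ (λ g → ℤ→ℚ (c g) * Σℚ (λ j → w j * χ j g))  ≤⟨ Σℚ-mono (λ g → scale-≤ (c≥0 g) (below g)) ⟩
    c · x                                           ∎
    where
      open ≤-Reasoning
      χ : Fin r → Vec G
      χ j = χδ G (S j)

      average-of-λ : Σℚ (λ j → w j * ℤ→ℚ λ₀) ≡ ℤ→ℚ λ₀
      average-of-λ = trans (Σℚ-*ʳ (ℤ→ℚ λ₀) w) (trans (cong (_* ℤ→ℚ λ₀) Σw≡1) (*-identityˡ (ℤ→ℚ λ₀)))

  -- Moving off a tight point of a valid inequality along coordinate f
  -- shows c_f ≥ 0.
  valid-tight-nonneg : ∀ c λ₀ → Valid G c λ₀ → (x₀ : Vec G) → InFace G c λ₀ x₀ →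
                       ∀ f → 0ℚ ℚ.≤ ℤ→ℚ (c f)
  valid-tight-nonneg c λ₀ valid x₀ (x₀∈CUT , tight) f =
    subst₂ ℚ._≤_ (+-inverseˡ (ℤ→ℚ λ₀)) (solve 2 (λ l a → (:- l) :+ (l :+ a) := a) refl (ℤ→ℚ λ₀) (ℤ→ℚ (c f)))
      (+-monoʳ-≤ (- ℤ→ℚ λ₀) λ≤λ+cf)
    where
      λ≤λ+cf : ℤ→ℚ λ₀ ℚ.≤ ℤ→ℚ λ₀ + ℤ→ℚ (c f)
      λ≤λ+cf = subst (ℤ→ℚ λ₀ ℚ.≤_) (trans (·-raise c x₀ f) (cong (_+ ℤ→ℚ (c f)) tight))
                 (valid (raise x₀ f) (raise-upward f x₀∈CUT))

  affine-family-not-dependent : ∀ {k} (p : Fin (suc k) → Vec G) → AffIndep G k p →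
                                ¬ Dependent k (m G) (differences p)
  affine-family-not-dependent p independent (a , (i , ai≢0) , vanish) = ai≢0 (independent a vanish i)

  no-affine-family-beyond-dimension : ∀ {P : Vec G → Set} k → m G < k → ¬ HasAffIndep G P k
  no-affine-family-beyond-dimension k m<k (p , _ , independent) =
    affine-family-not-dependent p independent
      (dependent-if-more-than-dimension (m G) k m<k (differences p))

  face-differences-orthogonal : ∀ c λ₀ {k} (p : Fin (suc k) → Vec G) → (∀ i → InFace G c λ₀ (p i)) →
    ∀ i → Σℚ (λ g → ℤ→ℚ (c g) * differences p i g) ≡ 0ℚ
  face-differences-orthogonal c λ₀ p in-face i = trans (·-differences c (p (suc i)) (p zero))
    (trans (cong₂ _-_ (proj₂ (in-face (suc i))) (proj₂ (in-face zero))) (+-inverseʳ (ℤ→ℚ λ₀)))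

  face-no-affine-family : ∀ c λ₀ k (g : Edge G) → ℤ→ℚ (c g) ≢ 0ℚ → m G ≤ k →
                          ¬ HasAffIndep G (InFace G c λ₀) k
  face-no-affine-family c λ₀ k g cg≢0 m≤k (p , in-face , independent) =
    affine-family-not-dependent p independent
      (dependent-in-hyperplane (m G) k m≤k (differences p) (λ j → ℤ→ℚ (c j)) g cg≢0
         (face-differences-orthogonal c λ₀ p in-face))

  facet-point : ∀ c λ₀ → FacetDefining G c λ₀ → Σ (Vec G) (InFace G c λ₀)
  facet-point c λ₀ (_ , _ , ((p , p∈face , _) , _) , _) = p zero , p∈face zero

  CUT-affine-family : ∀ k → k ≤ m G → (x₀ : Vec G) → InCUT G x₀ → HasAffIndep G (InCUT G) k
  CUT-affine-family k k≤m x₀ x₀∈CUT = p , in-CUT , independent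
    where
      ι : Fin k → Edge G
      ι i = Fin.inject≤ i k≤m
      p : Fin (suc k) → Vec G
      p zero    = x₀
      p (suc i) = raise x₀ (ι i)
      in-CUT : ∀ i → InCUT G (p i)
      in-CUT zero    = x₀∈CUT
      in-CUT (suc i) = raise-upward (ι i) x₀∈CUT
      raise-diff : ∀ g f → raise x₀ f g - x₀ g ≡ δ g f
      raise-diff g f = solve 2 (λ x d → x :+ d :- x := d) refl (x₀ g) (δ g f)
      δ-ι : ∀ i j → differences p i (ι j) ≡ δ i j
      δ-ι i j with i Fin.≟ j
      ... | yes refl = trans (raise-diff (ι i) (ι i)) (δ-diag (ι i))
      ... | no i≢j   = trans (raise-diff (ι j) (ι i))
                         (δ-off (λ ιj≡ιi → i≢j (sym (FinP.inject≤-injective k≤m k≤m j i ιj≡ιi))))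
      independent : AffIndep G k p
      independent a vanish i₀ =
        trans (sym (Σℚ-δ a i₀)) (trans (Σℚ-cong (λ i → cong (a i *_) (sym (δ-ι i i₀)))) (vanish (ι i₀)))

  -- a facet-defining inequality has a nonzero coefficient: otherwise its
  -- face would be all of CUT(G), of too large a dimension
  facet-nonzero-coefficient : ∀ c λ₀ d → HasDim G (InFace G c λ₀) d →
    HasAffIndep G (InCUT G) (suc d) → ∃ λ g → ℤ→ℚ (c g) ≢ 0ℚ
  facet-nonzero-coefficient c λ₀ d (face-family , face-bound) (q , q∈CUT , independent)
    with FinP.any? (λ g → ¬? (ℤ→ℚ (c g) ≟ 0ℚ))
  ... | yes nonzero = nonzero
  ... | no  none    = ⊥-elim (face-bound (q , (λ i → q∈CUT i , trans (c·≡0 (q i)) (sym λ≡0)) , independent))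
    where
      c≡0 : ∀ g → ℤ→ℚ (c g) ≡ 0ℚ
      c≡0 = all-zero (λ g → ℤ→ℚ (c g)) none
      c·≡0 : ∀ x → c · x ≡ 0ℚ
      c·≡0 x = Σℚ-zero _ (λ g → trans (cong (_* x g) (c≡0 g)) (*-zeroˡ (x g)))
      λ≡0 : ℤ→ℚ λ₀ ≡ 0ℚ
      λ≡0 = trans (sym (proj₂ (proj₁ (proj₂ face-family) zero))) (c·≡0 _)

  edges-bounded-by-dimension : ∀ d (x₀ : Vec G) → InCUT G x₀ →
    ¬ HasAffIndep G (InCUT G) (suc (suc d)) → m G ≤ suc d
  edges-bounded-by-dimension d x₀ x₀∈CUT bound with suc (suc d) ℕ.≤? m G
  ... | yes d+2≤m = ⊥-elim (bound (CUT-affine-family (suc (suc d)) d+2≤m x₀ x₀∈CUT))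
  ... | no  d+2≰m = ℕP.≤-pred (ℕP.≰⇒> d+2≰m)

open CutDominant hiding (_·_)

-- G' arises from G by removing the edge e and mapping
-- the nodes along a surjection φ; through ψ the edges of G' correspond
-- to the edges of G other than e.  So a vector on E(G) is a value at e
-- together with a vector on E(G'), and an inequality for G' extends to
-- G by choosing a coefficient for e.

module MinorStep (G G' : Graph) (e : Edge G) (φ : Node G → Node G')
                 (φ-onto : ∀ a' → ∃ λ a → φ a ≡ a') (edges : EdgeMap G G' e φ) where

  open CutDominant G using (_·_)
  open CutDominant G' using () renaming (_·_ to _·′_)

  ψ : Edge G' → Edge G
  ψ = proj₁ edges

  ψ-injective : ∀ f g → ψ f ≡ ψ g → f ≡ g
  ψ-injective = proj₁ (proj₂ edges)

  ψ≢e : ∀ f → ¬ ψ f ≡ e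
  ψ≢e = proj₁ (proj₂ (proj₂ edges))

  ψ-onto : ∀ g → ¬ g ≡ e → ∃ λ f → ψ f ≡ g
  ψ-onto = proj₁ (proj₂ (proj₂ (proj₂ edges)))

  ψ-ends : (f : Edge G') →
    (φ (proj₁ (ends G (ψ f))) ≡ proj₁ (ends G' f) × φ (proj₂ (ends G (ψ f))) ≡ proj₂ (ends G' f)) ⊎
    (φ (proj₁ (ends G (ψ f))) ≡ proj₂ (ends G' f) × φ (proj₂ (ends G (ψ f))) ≡ proj₁ (ends G' f))
  ψ-ends = proj₂ (proj₂ (proj₂ (proj₂ edges)))

  -- E(G) ≅ {e} ⊎ E(G'), with e at index zero
  toEdge : Fin (suc (m G')) → Edge G
  toEdge zero    = e
  toEdge (suc f) = ψ f

  fromEdge : Edge G → Fin (suc (m G'))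
  fromEdge g with g Fin.≟ e
  ... | yes _   = zero
  ... | no  g≢e = suc (proj₁ (ψ-onto g g≢e))

  toEdge-fromEdge : ∀ g → toEdge (fromEdge g) ≡ g
  toEdge-fromEdge g with g Fin.≟ e
  ... | yes g≡e = sym g≡e
  ... | no  g≢e = proj₂ (ψ-onto g g≢e)

  fromEdge-toEdge : ∀ i → fromEdge (toEdge i) ≡ i
  fromEdge-toEdge zero with e Fin.≟ e
  ... | yes _   = refl
  ... | no  e≢e = ⊥-elim (e≢e refl)
  fromEdge-toEdge (suc f) with ψ f Fin.≟ e
  ... | yes ψf≡e = ⊥-elim (ψ≢e f ψf≡e)
  ... | no  ψf≢e = cong suc (ψ-injective _ _ (proj₂ (ψ-onto (ψ f) ψf≢e)))

  edge-permutation : Permutation (suc (m G')) (m G)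
  edge-permutation = permutation toEdge fromEdge toEdge-fromEdge fromEdge-toEdge

  edge-count : m G ≡ suc (m G')
  edge-count = sym (↔⇒≡ edge-permutation)

  Σℚ-edges : ∀ (h : Edge G → ℚ) → Σℚ h ≡ h e + Σℚ (λ f → h (ψ f))
  Σℚ-edges h = begin
    Σℚ h                      ≡⟨ Σℚ≡sum h ⟩
    ∑.sum h                   ≡⟨ ∑.sum-permute h edge-permutation ⟩
    ∑.sum (λ i → h (toEdge i)) ≡⟨ sym (Σℚ≡sum (λ i → h (toEdge i))) ⟩
    h e + Σℚ (λ f → h (ψ f))  ∎
    where open ≡-Reasoning

  extend : {A : Set} → A → (Edge G' → A) → Edge G → A
  extend a x g = (a ∷ x) (fromEdge g)

  extend-e : ∀ {A : Set} (a : A) x → extend a x e ≡ a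
  extend-e a x = cong (a ∷ x) (fromEdge-toEdge zero)

  extend-ψ : ∀ {A : Set} (a : A) x f → extend a x (ψ f) ≡ x f
  extend-ψ a x f = cong (a ∷ x) (fromEdge-toEdge (suc f))

  edge-cases : (Q : Edge G → Set) → Q e → (∀ f → Q (ψ f)) → ∀ g → Q g
  edge-cases Q Qe Qψ g = subst Q (toEdge-fromEdge g) (at (fromEdge g))
    where
      at : ∀ i → Q (toEdge i)
      at zero    = Qe
      at (suc f) = Qψ f

  ·-extend : ∀ M c (x : Vec G) → extend M c · x ≡ ℤ→ℚ M * x e + c ·′ (λ f → x (ψ f))
  ·-extend M c x = trans (Σℚ-edges (λ g → ℤ→ℚ (extend M c g) * x g))
    (cong₂ _+_ (cong (λ z → ℤ→ℚ z * x e) (extend-e M c))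
               (Σℚ-cong (λ f → cong (λ z → ℤ→ℚ z * x (ψ f)) (extend-ψ M c f))))

  ·-extend-extend : ∀ M c s x → extend M c · extend s x ≡ ℤ→ℚ M * s + c ·′ x
  ·-extend-extend M c s x = trans (·-extend M c (extend s x))
    (cong₂ _+_ (cong (ℤ→ℚ M *_) (extend-e s x)) (Σℚ-cong (λ f → cong (ℤ→ℚ (c f) *_) (extend-ψ s x f))))

  -- a common divisor of the extended coefficients and λ divides those of c
  min-form-extend : ∀ M c λ₀ → MinIntegerForm G' c λ₀ → MinIntegerForm G (extend M c) λ₀
  min-form-extend M c λ₀ min-form d d∣coefficients d∣λ =
    min-form d (λ f → subst (λ z → d ∣ ℤ.∣ z ∣) (extend-ψ M c f) (d∣coefficients (ψ f))) d∣λ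

  χδ-ψ : (S : NodeSet G) (S' : NodeSet G') → (∀ a → S' (φ a) ≡ S a) → ∀ f → χδ G S (ψ f) ≡ χδ G' S' f
  χδ-ψ S S' S'∘φ≡S f with ψ-ends f
  ... | inj₁ (p , q) = cong bool→ℚ (cong₂ _xor_ (trans (sym (S'∘φ≡S _)) (cong S' p))
                                                (trans (sym (S'∘φ≡S _)) (cong S' q)))
  ... | inj₂ (p , q) = cong bool→ℚ (trans (cong₂ _xor_ (trans (sym (S'∘φ≡S _)) (cong S' p))
                                                       (trans (sym (S'∘φ≡S _)) (cong S' q)))
                                          (xor-comm (S' (proj₂ (ends G' f))) (S' (proj₁ (ends G' f)))))

  proper-pullback : ∀ S' → ProperNonempty G' S' → ProperNonempty G (λ a → S' (φ a))
  proper-pullback S' ((v , S'v) , (w , ¬S'w)) =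
    (proj₁ (φ-onto v) , trans (cong S' (proj₂ (φ-onto v))) S'v) ,
    (proj₁ (φ-onto w) , trans (cong S' (proj₂ (φ-onto w))) ¬S'w)

  proper-pushforward : ∀ S S' → (∀ a → S' (φ a) ≡ S a) → ProperNonempty G S → ProperNonempty G' S'
  proper-pushforward S S' S'∘φ≡S ((v , Sv) , (w , ¬Sw)) =
    (φ v , trans (S'∘φ≡S v) Sv) , (φ w , trans (S'∘φ≡S w) ¬Sw)

  extend-in-CUT : ∀ t x → InCUT G' x →
    (∀ S' → ProperNonempty G' S' → χδ G (λ a → S' (φ a)) e ℚ.≤ t) → InCUT G (extend t x)
  extend-in-CUT t x (r , w , S , proper , w≥0 , Σw≡1 , below) pullback≤t =
    r , w , pulled , (λ j → proper-pullback (S j) (proper j)) , w≥0 , Σw≡1 ,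
    edge-cases (λ g → Σℚ (λ j → w j * χδ G (pulled j) g) ℚ.≤ extend t x g)
      (subst (Σℚ (λ j → w j * χδ G (pulled j) e) ℚ.≤_) (sym (extend-e t x))
        (convex-bound w (λ j → χδ G (pulled j) e) t w≥0 Σw≡1 (λ j → pullback≤t (S j) (proper j))))
      (λ f → subst₂ ℚ._≤_ (Σℚ-cong (λ j → cong (w j *_) (sym (χδ-ψ (pulled j) (S j) (λ a → refl) f))))
                          (sym (extend-ψ t x f)) (below f))
    where
      pulled : Fin r → NodeSet G
      pulled j a = S j (φ a)

  extend-upward : ∀ {s s′} x → s ℚ.≤ s′ → InCUT G (extend s x) → InCUT G (extend s′ x)
  extend-upward {s} {s′} x s≤s′ in-CUT = CUT-upward G in-CUT
    (edge-cases (λ g → extend s x g ℚ.≤ extend s′ x g)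
      (subst₂ ℚ._≤_ (sym (extend-e s x)) (sym (extend-e s′ x)) s≤s′)
      (λ f → ≤-reflexive (trans (extend-ψ s x f) (sym (extend-ψ s′ x f)))))

  -- Affinely independent points p_0..p_k of P' stay independent when
  -- extended by the common value t, and remain so after adding one point
  -- q with q_e = t + 1, the only point that moves off the level x_e = t.
  lift-affine-family : ∀ {P : Vec G → Set} {P' : Vec G' → Set} k t →
    (∀ x → P' x → P (extend t x)) → HasAffIndep G' P' k →
    (q : Vec G) → P q → q e ≡ t + 1ℚ → HasAffIndep G P (suc k)
  lift-affine-family {P} {P'} k t lift (p , p∈P' , independent) q q∈P qe≡t+1 = Q , Q∈P , Q-independent
    where
      Q : Fin (suc (suc k)) → Vec G
      Q zero          = extend t (p zero)
      Q (suc zero)    = q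
      Q (suc (suc i)) = extend t (p (suc i))

      Q∈P : ∀ i → P (Q i)
      Q∈P zero          = lift (p zero) (p∈P' zero)
      Q∈P (suc zero)    = q∈P
      Q∈P (suc (suc i)) = lift (p (suc i)) (p∈P' (suc i))

      Q-independent : AffIndep G (suc k) Q
      Q-independent a vanish = coefficients
        where
          rest : Edge G → ℚ
          rest g = Σℚ (λ i → a (suc i) * (Q (suc (suc i)) g - Q zero g))

          rest-at-e : rest e ≡ 0ℚ
          rest-at-e = Σℚ-zero _ (λ i →
            trans (cong₂ (λ u v → a (suc i) * (u - v)) (extend-e t (p (suc i))) (extend-e t (p zero)))
                  (solve 2 (λ A T → A :* (T :- T) := con 0ℚ) refl (a (suc i)) t))

          a₀≡0 : a zero ≡ 0ℚ
          a₀≡0 = begin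
            a zero                                   ≡⟨ solve 2 (λ A T → A := A :* ((T :+ con 1ℚ) :- T) :+ con 0ℚ)
                                                          refl (a zero) t ⟩
            a zero * ((t + 1ℚ) - t) + 0ℚ             ≡⟨ cong₂ (λ u v → a zero * (u - v) + 0ℚ)
                                                          (sym qe≡t+1) (sym (extend-e t (p zero))) ⟩
            a zero * (q e - Q zero e) + 0ℚ           ≡⟨ cong (a zero * (q e - Q zero e) +_) (sym rest-at-e) ⟩
            a zero * (q e - Q zero e) + rest e       ≡⟨ vanish e ⟩
            0ℚ                                       ∎
            where open ≡-Reasoning

          vanish′ : ∀ f → Σℚ (λ i → a (suc i) * differences G' p i f) ≡ 0ℚ
          vanish′ f = begin
            Σℚ (λ i → a (suc i) * differences G' p i f)
              ≡⟨ Σℚ-cong (λ i → cong₂ (λ u v → a (suc i) * (u - v))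
                                  (sym (extend-ψ t (p (suc i)) f)) (sym (extend-ψ t (p zero) f))) ⟩
            rest (ψ f)
              ≡⟨ sym (+-identityˡ (rest (ψ f))) ⟩
            0ℚ + rest (ψ f)
              ≡⟨ cong (_+ rest (ψ f)) (sym (trans (cong (_* (q (ψ f) - Q zero (ψ f))) a₀≡0) (*-zeroˡ (q (ψ f) - Q zero (ψ f))))) ⟩
            a zero * (q (ψ f) - Q zero (ψ f)) + rest (ψ f)
              ≡⟨ vanish (ψ f) ⟩
            0ℚ ∎
            where open ≡-Reasoning

          coefficients : ∀ i → a i ≡ 0ℚ
          coefficients zero    = a₀≡0
          coefficients (suc i) = independent (λ i → a (suc i)) vanish′ i

  -- If extension by a value
  -- t with M·t = 0 maps CUT(G') into CUT(G), and the face of the lifted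
  -- inequality contains a point q with q_e = t + 1, then the lifted inequality is facet-defining
  -- for CUT(G): both the face and CUT gain exactly one dimension.
  lift-facet : ∀ c λ₀ M t → FacetDefining G' c λ₀ → Valid G (extend M c) λ₀ →
    (∀ x → InCUT G' x → InCUT G (extend t x)) → ℤ→ℚ M * t ≡ 0ℚ →
    (Σ (Vec G) λ q → InFace G (extend M c) λ₀ q × q e ≡ t + 1ℚ) →
    FacetDefining G (extend M c) λ₀
  lift-facet c λ₀ M t (_ , d , (face-family , face-bound) , (CUT-family , CUT-bound)) valid lift Mt≡0
             (q , q∈face , qe≡t+1) =
    valid , suc d , (face-family′ , face-bound′) , (CUT-family′ , CUT-bound′)
    where
      x₁ : Vec G'
      x₁ = proj₁ CUT-family zero
      x₁∈CUT : InCUT G' x₁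
      x₁∈CUT = proj₁ (proj₂ CUT-family) zero

      m′≤d+1 : m G' ≤ suc d
      m′≤d+1 = edges-bounded-by-dimension G' d x₁ x₁∈CUT CUT-bound

      m≤d+2 : m G ≤ suc (suc d)
      m≤d+2 = subst (_≤ suc (suc d)) (sym edge-count) (ℕ.s≤s m′≤d+1)

      lift-face : ∀ x → InFace G' c λ₀ x → InFace G (extend M c) λ₀ (extend t x)
      lift-face x (x∈CUT , tight) = lift x x∈CUT ,
        trans (·-extend-extend M c t x) (trans (cong (_+ c ·′ x) Mt≡0) (trans (+-identityˡ (c ·′ x)) tight))

      face-family′ : HasAffIndep G (InFace G (extend M c) λ₀) (suc d)
      face-family′ = lift-affine-family {InFace G (extend M c) λ₀} {InFace G' c λ₀} d t lift-face face-family
                       q q∈face qe≡t+1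

      CUT-family′ : HasAffIndep G (InCUT G) (suc (suc d))
      CUT-family′ = lift-affine-family {InCUT G} {InCUT G'} (suc d) t lift CUT-family (extend (t + 1ℚ) x₁)
        (extend-upward x₁ (p≤p+q 0≤1) (lift x₁ x₁∈CUT)) (extend-e (t + 1ℚ) x₁)

      CUT-bound′ : ¬ HasAffIndep G (InCUT G) (suc (suc (suc d)))
      CUT-bound′ = no-affine-family-beyond-dimension G {InCUT G} (suc (suc (suc d))) (ℕ.s≤s m≤d+2)

      face-bound′ : ¬ HasAffIndep G (InFace G (extend M c) λ₀) (suc (suc d))
      face-bound′ with facet-nonzero-coefficient G' c λ₀ d (face-family , face-bound) CUT-family
      ... | g , cg≢0 = face-no-affine-family G (extend M c) λ₀ (suc (suc d)) (ψ g)
                         (subst (λ z → ℤ→ℚ z ≢ 0ℚ) (sym (extend-ψ M c g)) cg≢0) m≤d+2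

-- Deleting an edge e: a facet ⟨c,x⟩ ≥ λ of CUT(G∖e) extends with
-- coefficient 0 on e to a facet of CUT(G).  Here φ is a bijection, so
-- cuts of G and of G∖e correspond exactly.

module DeletionStep (G G' : Graph) (e : Edge G) (φ : Node G → Node G')
                    (φ-injective : ∀ a b → φ a ≡ φ b → a ≡ b) (φ-onto : ∀ a' → ∃ λ a → φ a ≡ a')
                    (edges : EdgeMap G G' e φ) where

  open MinorStep G G' e φ φ-onto edges
  open CutDominant G using (_·_)
  open CutDominant G' using () renaming (_·_ to _·′_)

  pushforward : NodeSet G → NodeSet G'
  pushforward S a' = S (proj₁ (φ-onto a'))

  pushforward-φ : ∀ S a → pushforward S (φ a) ≡ S a
  pushforward-φ S a = cong S (φ-injective _ _ (proj₂ (φ-onto (φ a))))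

  restrict-in-CUT : ∀ x → InCUT G x → InCUT G' (λ f → x (ψ f))
  restrict-in-CUT x (r , w , S , proper , w≥0 , Σw≡1 , below) =
    r , w , (λ j → pushforward (S j)) ,
    (λ j → proper-pushforward (S j) (pushforward (S j)) (pushforward-φ (S j)) (proper j)) , w≥0 , Σw≡1 ,
    λ f → subst (ℚ._≤ x (ψ f)) (Σℚ-cong (λ j → cong (w j *_) (χδ-ψ (S j) (pushforward (S j)) (pushforward-φ (S j)) f)))
                (below (ψ f))

  -- lifted by the value 1 ≥ χ_e, a point of CUT(G') lies in CUT(G)
  lift : ∀ x → InCUT G' x → InCUT G (extend 1ℚ x)
  lift x x∈CUT = extend-in-CUT 1ℚ x x∈CUT
    (λ S' _ → bool≤1 (S' (φ (proj₁ (ends G e))) xor S' (φ (proj₂ (ends G e)))))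
    where
      bool≤1 : ∀ b → bool→ℚ b ℚ.≤ 1ℚ
      bool≤1 true  = ≤-refl
      bool≤1 false = 0≤1

  deletion-lifts-facet : ∀ c λ₀ → FacetDefining G' c λ₀ → FacetDefining G (extend (ℤ.+ 0) c) λ₀
  deletion-lifts-facet c λ₀ facet =
    lift-facet c λ₀ (ℤ.+ 0) 1ℚ facet valid lift (*-zeroˡ 1ℚ) (uncurry raised (facet-point G' c λ₀ facet))
    where
      valid : Valid G (extend (ℤ.+ 0) c) λ₀
      valid x x∈CUT = subst (ℤ→ℚ λ₀ ℚ.≤_) (sym value) (proj₁ facet _ (restrict-in-CUT x x∈CUT))
        where
          value : extend (ℤ.+ 0) c · x ≡ c ·′ (λ f → x (ψ f))
          value = trans (·-extend (ℤ.+ 0) c x)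
            (trans (cong (_+ c ·′ (λ f → x (ψ f))) (*-zeroˡ (x e))) (+-identityˡ _))

      raised : ∀ x → InFace G' c λ₀ x →
               Σ (Vec G) λ q → InFace G (extend (ℤ.+ 0) c) λ₀ q × q e ≡ 1ℚ + 1ℚ
      raised x (x∈CUT , tight) =
        extend (1ℚ + 1ℚ) x ,
        (extend-upward x (p≤p+q 0≤1) (lift x x∈CUT) ,
         trans (·-extend-extend (ℤ.+ 0) c (1ℚ + 1ℚ) x)
               (trans (cong (_+ c ·′ x) (*-zeroˡ (1ℚ + 1ℚ))) (trans (+-identityˡ (c ·′ x)) tight))) ,
        extend-e (1ℚ + 1ℚ) x

deletion-preserves-k-graph : ∀ {G G'} k → Deletion G G' → IsKGraph G k → IsKGraph G' k
deletion-preserves-k-graph {G} {G'} k (e , φ , φ-injective , φ-onto , edges) G-is-k c λ₀ facet min-form =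
  G-is-k (extend (ℤ.+ 0) c) λ₀ (deletion-lifts-facet c λ₀ facet) (min-form-extend (ℤ.+ 0) c λ₀ min-form)
  where
    open MinorStep G G' e φ φ-onto edges using (extend; min-form-extend)
    open DeletionStep G G' e φ φ-injective φ-onto edges using (deletion-lifts-facet)

-- Contracting an edge e = uv: a facet ⟨c,x⟩ ≥ λ of CUT(G/e) extends to
-- a facet M·x_e + ⟨c,x⟩ ≥ λ of CUT(G), where M is the largest amount by
-- which a cut of G through e falls short of λ on the other edges (or 0).
-- Cuts of G avoiding e are exactly the cuts of G/e.

module ContractionStep (G G' : Graph) (e : Edge G) (φ : Node G → Node G')
  (φ-identifies : ∀ a b → (φ a ≡ φ b) ⇔
     (a ≡ b ⊎ (a ≡ proj₁ (ends G e) × b ≡ proj₂ (ends G e)) ⊎ (a ≡ proj₂ (ends G e) × b ≡ proj₁ (ends G e))))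
  (φ-onto : ∀ a' → ∃ λ a → φ a ≡ a') (edges : EdgeMap G G' e φ) where

  open MinorStep G G' e φ φ-onto edges
  open CutDominant G using (_·_)
  open CutDominant G' using () renaming (_·_ to _·′_)

  u v : Node G
  u = proj₁ (ends G e)
  v = proj₂ (ends G e)

  φu≡φv : φ u ≡ φ v
  φu≡φv = Equivalence.from (φ-identifies u v) (inj₂ (inj₁ (refl , refl)))

  -- whether edge g lies in δ(S); χδ G S g is bool→ℚ (crosses S g) by definition
  crosses : NodeSet G → Edge G → Bool
  crosses S g = S (proj₁ (ends G g)) xor S (proj₂ (ends G g))

  pullback-avoids-e : ∀ S' → χδ G (λ a → S' (φ a)) e ≡ 0ℚ
  pullback-avoids-e S' = cong bool→ℚ (begin
    S' (φ u) xor S' (φ v)  ≡⟨ cong (S' (φ u) xor_) (cong S' (sym φu≡φv)) ⟩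
    S' (φ u) xor S' (φ u)  ≡⟨ xor-same (S' (φ u)) ⟩
    false                  ∎)
    where open ≡-Reasoning

  -- a node set with e ∉ δ(S) does not separate u from v, hence is
  -- pulled back from the node set S ∘ φ⁻¹ of G/e
  pushforward : NodeSet G → NodeSet G'
  pushforward S a' = S (proj₁ (φ-onto a'))

  same-side : ∀ S → crosses S e ≡ false → S u ≡ S v
  same-side S = xor-false (S u) (S v)
    where
      xor-false : ∀ a b → a xor b ≡ false → a ≡ b
      xor-false true  true  _ = refl
      xor-false false false _ = refl

  pushforward-φ : ∀ S → crosses S e ≡ false → ∀ a → pushforward S (φ a) ≡ S a
  pushforward-φ S e∉δS a with Equivalence.to (φ-identifies (proj₁ (φ-onto (φ a))) a) (proj₂ (φ-onto (φ a)))
  ... | inj₁ same               = cong S same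
  ... | inj₂ (inj₁ (≡u , a≡v)) = trans (cong S ≡u) (trans (same-side S e∉δS) (cong S (sym a≡v)))
  ... | inj₂ (inj₂ (≡v , a≡u)) = trans (cong S ≡v) (trans (sym (same-side S e∉δS)) (cong S (sym a≡u)))

  crossing-proper : ∀ S → crosses S e ≡ true → ProperNonempty G S
  crossing-proper S = proper (S u) (S v) refl refl
    where
      proper : ∀ a b → S u ≡ a → S v ≡ b → a xor b ≡ true → ProperNonempty G S
      proper true  false Su Sv _ = (u , Su) , (v , Sv)
      proper false true  Su Sv _ = (v , Sv) , (u , Su)
      proper true  true  _  _  ()
      proper false false _  _  ()

  lift : ∀ x → InCUT G' x → InCUT G (extend 0ℚ x)
  lift x x∈CUT = extend-in-CUT 0ℚ x x∈CUT (λ S' _ → ≤-reflexive (pullback-avoids-e S'))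

  module Lifting (c : Edge G' → ℤ) (λ₀ : ℤ) (facet : FacetDefining G' c λ₀) where

    rest : NodeSet G → ℤ
    rest S = ∑ℤ.sum (λ f → c f ℤ.* bool→ℤ (crosses S (ψ f)))

    rest-ℚ : ∀ S → ℤ→ℚ (rest S) ≡ c ·′ (λ f → χδ G S (ψ f))
    rest-ℚ S = trans (ℤ→ℚ-sum (λ f → c f ℤ.* bool→ℤ (crosses S (ψ f))))
                     (Σℚ-cong (λ f → ℤ→ℚ-*-bool (c f) (crosses S (ψ f))))

    shortfall : NodeSet G → ℤ
    shortfall S = if crosses S e then λ₀ ℤ.- rest S else ℤ.+ 0

    shortfall-respects : ∀ S T → (∀ a → S a ≡ T a) → shortfall S ≡ shortfall T
    shortfall-respects S T S≗T =
      cong₂ (λ b r → if b then λ₀ ℤ.- r else ℤ.+ 0) (crosses-respects e)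
            (∑ℤ.sum-cong-≗ (λ f → cong (λ b → c f ℤ.* bool→ℤ b) (crosses-respects (ψ f))))
      where
        crosses-respects : ∀ g → crosses S g ≡ crosses T g
        crosses-respects g = cong₂ _xor_ (S≗T _) (S≗T _)

    shortfall-crossing : ∀ S → crosses S e ≡ true → shortfall S ≡ λ₀ ℤ.- rest S
    shortfall-crossing S e∈δS rewrite e∈δS = refl

    shortfall-avoiding : ∀ S → crosses S e ≡ false → shortfall S ≡ ℤ.+ 0
    shortfall-avoiding S e∉δS rewrite e∉δS = refl

    S₀ : NodeSet G
    S₀ = proj₁ (maximum-over-subsets (n G) shortfall shortfall-respects)

    M : ℤ
    M = shortfall S₀

    shortfall≤M : ∀ S → shortfall S ℤ.≤ M
    shortfall≤M = proj₂ (maximum-over-subsets (n G) shortfall shortfall-respects)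

    -- the empty set has shortfall 0
    M≥0 : ℤ.+ 0 ℤ.≤ M
    M≥0 = shortfall≤M (λ _ → false)

    ·-cut : ∀ S → extend M c · χδ G S ≡ ℤ→ℚ M * bool→ℚ (crosses S e) + ℤ→ℚ (rest S)
    ·-cut S = trans (·-extend M c (χδ G S)) (cong (ℤ→ℚ M * bool→ℚ (crosses S e) +_) (sym (rest-ℚ S)))

    ·-crossing-cut : ∀ S → crosses S e ≡ true → extend M c · χδ G S ≡ ℤ→ℚ (M ℤ.+ rest S)
    ·-crossing-cut S e∈δS = begin
      extend M c · χδ G S                                 ≡⟨ ·-cut S ⟩
      ℤ→ℚ M * bool→ℚ (crosses S e) + ℤ→ℚ (rest S)         ≡⟨ cong (λ b → ℤ→ℚ M * bool→ℚ b + ℤ→ℚ (rest S)) e∈δS ⟩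
      ℤ→ℚ M * 1ℚ + ℤ→ℚ (rest S)                           ≡⟨ cong (_+ ℤ→ℚ (rest S)) (*-identityʳ (ℤ→ℚ M)) ⟩
      ℤ→ℚ M + ℤ→ℚ (rest S)                                ≡⟨ sym (ℤ→ℚ-+ M (rest S)) ⟩
      ℤ→ℚ (M ℤ.+ rest S)                                  ∎
      where open ≡-Reasoning

    crossing-cut-value : ∀ S → crosses S e ≡ true → ℤ→ℚ λ₀ ℚ.≤ extend M c · χδ G S
    crossing-cut-value S e∈δS = subst (ℤ→ℚ λ₀ ℚ.≤_) (sym (·-crossing-cut S e∈δS)) (ℤ→ℚ-mono λ₀≤M+rest)
      where
        λ₀≤M+rest : λ₀ ℤ.≤ M ℤ.+ rest S
        λ₀≤M+rest = subst (ℤ._≤ M ℤ.+ rest S) ([a-b]+b≡a λ₀ (rest S))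
          (ℤP.+-monoˡ-≤ (rest S) (subst (ℤ._≤ M) (shortfall-crossing S e∈δS) (shortfall≤M S)))

    -- a cut avoiding e is a cut of G/e, which satisfies the facet inequality
    avoiding-cut-value : ∀ S → crosses S e ≡ false → ProperNonempty G S → ℤ→ℚ λ₀ ℚ.≤ extend M c · χδ G S
    avoiding-cut-value S e∉δS proper =
      subst (ℤ→ℚ λ₀ ℚ.≤_) (sym value)
        (proj₁ facet (χδ G' S') (cut-in-CUT G' S' (proper-pushforward S S' (pushforward-φ S e∉δS) proper)))
      where
        S' : NodeSet G'
        S' = pushforward S
        value : extend M c · χδ G S ≡ c ·′ χδ G' S'
        value = begin
          extend M c · χδ G S                         ≡⟨ ·-extend M c (χδ G S) ⟩
          ℤ→ℚ M * χδ G S e + c ·′ (λ f → χδ G S (ψ f)) ≡⟨ cong₂ _+_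
                                                           (trans (cong (λ b → ℤ→ℚ M * bool→ℚ b) e∉δS) (*-zeroʳ (ℤ→ℚ M)))
                                                           (Σℚ-cong (λ f → cong (ℤ→ℚ (c f) *_)
                                                              (χδ-ψ S S' (pushforward-φ S e∉δS) f))) ⟩
          0ℚ + c ·′ χδ G' S'                          ≡⟨ +-identityˡ (c ·′ χδ G' S') ⟩
          c ·′ χδ G' S'                               ∎
          where open ≡-Reasoning

    valid : Valid G (extend M c) λ₀
    valid = valid-from-cuts G (extend M c) λ₀ coefficients-nonneg cut-value
      where
        coefficients-nonneg : ∀ g → 0ℚ ℚ.≤ ℤ→ℚ (extend M c g)
        coefficients-nonneg = edge-cases (λ g → 0ℚ ℚ.≤ ℤ→ℚ (extend M c g))
          (subst (λ z → 0ℚ ℚ.≤ ℤ→ℚ z) (sym (extend-e M c)) (ℤ→ℚ-mono M≥0))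
          (λ f → subst (λ z → 0ℚ ℚ.≤ ℤ→ℚ z) (sym (extend-ψ M c f))
                   (uncurry (valid-tight-nonneg G' c λ₀ (proj₁ facet)) (facet-point G' c λ₀ facet) f))
        cut-value : ∀ S → ProperNonempty G S → ℤ→ℚ λ₀ ℚ.≤ extend M c · χδ G S
        cut-value S proper with crosses S e in e∈?δS
        ... | true  = crossing-cut-value S e∈?δS
        ... | false = avoiding-cut-value S e∈?δS proper

    -- The face contains a point with x_e = 1: the tight cut δ(S₀) if it
    -- contains e, and otherwise (then M = 0) any lifted face point raised.
    raised : ∀ x → InFace G' c λ₀ x → Σ (Vec G) λ q → InFace G (extend M c) λ₀ q × q e ≡ 0ℚ + 1ℚ
    raised x (x∈CUT , tight) = by-cases (crosses S₀ e) refl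
      where
        by-cases : ∀ b → crosses S₀ e ≡ b →
                   Σ (Vec G) λ q → InFace G (extend M c) λ₀ q × q e ≡ 0ℚ + 1ℚ
        by-cases true e∈δS₀ =
          χδ G S₀ , (cut-in-CUT G S₀ (crossing-proper S₀ e∈δS₀) , tight₀) ,
          trans (cong bool→ℚ e∈δS₀) (sym (+-identityˡ 1ℚ))
          where
            tight₀ : extend M c · χδ G S₀ ≡ ℤ→ℚ λ₀
            tight₀ = trans (·-crossing-cut S₀ e∈δS₀)
              (cong ℤ→ℚ (trans (cong (ℤ._+ rest S₀) (shortfall-crossing S₀ e∈δS₀)) ([a-b]+b≡a λ₀ (rest S₀))))
        by-cases false e∉δS₀ =
          extend 1ℚ x , (extend-upward x 0≤1 (lift x x∈CUT) , tight₁) ,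
          trans (extend-e 1ℚ x) (sym (+-identityˡ 1ℚ))
          where
            tight₁ : extend M c · extend 1ℚ x ≡ ℤ→ℚ λ₀
            tight₁ = trans (·-extend-extend M c 1ℚ x)
              (trans (cong (λ z → ℤ→ℚ z * 1ℚ + c ·′ x) (shortfall-avoiding S₀ e∉δS₀))
                     (trans (+-identityˡ (c ·′ x)) tight))

    contraction-lifts-facet : FacetDefining G (extend M c) λ₀
    contraction-lifts-facet =
      lift-facet c λ₀ M 0ℚ facet valid lift (*-zeroʳ (ℤ→ℚ M)) (uncurry raised (facet-point G' c λ₀ facet))

contraction-preserves-k-graph : ∀ {G G'} k → Contraction G G' → IsKGraph G k → IsKGraph G' k
contraction-preserves-k-graph {G} {G'} k (e , φ , φ-identifies , φ-onto , edges) G-is-k c λ₀ facet min-form =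
  G-is-k (extend M c) λ₀ contraction-lifts-facet (min-form-extend M c λ₀ min-form)
  where
    open MinorStep G G' e φ φ-onto edges using (extend; min-form-extend)
    open ContractionStep G G' e φ φ-identifies φ-onto edges using (module Lifting)
    open Lifting c λ₀ facet using (M; contraction-lifts-facet)

step-preserves-k-graph : ∀ {G G'} k → Step G G' → IsKGraph G k → IsKGraph G' k
step-preserves-k-graph k (inj₁ deletion)    = deletion-preserves-k-graph k deletion
step-preserves-k-graph k (inj₂ contraction) = contraction-preserves-k-graph k contraction

minor-preserves-k-graph : ∀ {G G'} k → ObtainedBy G G' → IsKGraph G k → IsKGraph G' k
minor-preserves-k-graph k ε              G-is-k = G-is-k
minor-preserves-k-graph k (step ◅ steps) G-is-k =
  minor-preserves-k-graph k steps (step-preserves-k-graph k step G-is-k)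

lemma1p3 : (G G' : Graph) → 2 ≤ n G → 2 ≤ n G' → ObtainedBy G G' →
    (k k' : ℕ) → IsKStar G k → IsKStar G' k' → k' ≤ k
lemma1p3 G G' _ _ obtained k k' (G-is-k , _) (_ , k'-least) =
  k'-least k (minor-preserves-k-graph k obtained G-is-k)
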